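{- Let $G$ be a graph of order $n\geqslant 5$ with minimum degree $\delta(G)$. Then: (1) if $\delta(G)\geqslant (n+1)/2$, then $\chi_i(G)=n$; (2) if $\delta(G)=\lfloor (n-1)/2\rfloor$, then $\chi_i(G)\geqslant \delta(G)+1$.
   Context: All graphs are finite and simple; the order of a graph is its number of vertices. A mapping $f:V(G)\to\{1,\ldots,k\}$ is an injective $k$-coloring of $G$ if $f(u)\neq f(v)$ whenever the distinct vertices $u$ and $v$ have a common neighbor in $G$ (adjacent vertices without a common neighbor may receive the same color). The injective chromatic number $\chi_i(G)$ is the minimum $k$ such that $G$ has an injective $k$-coloring. -}

module Defs where

open import Data.Nat using (ℕ; suc; _≤_; _+_; _*_; _∸_; _/_)
open import Data.Fin using (Fin)
open import Data.Bool using (Bool; true; false)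
open import Data.List using (List; length; filter)
open import Data.List using () renaming (allFin to allFinL)
open import Data.Product using (Σ; _×_; ∃-syntax)
open import Relation.Binary.PropositionalEquality using (_≡_; _≢_)
open import Relation.Nullary using (¬_)
open import Data.Bool using (T)
open import Relation.Nullary.Decidable using (does)
open import Data.Bool.Properties using (T?)

record Graph (n : ℕ) : Set where
  field
    adj       : Fin n → Fin n → Bool
    adj-sym   : ∀ u v → adj u v ≡ adj v u
    adj-irrefl : ∀ v → adj v v ≡ false
open Graph public

Adj : ∀ {n} → Graph n → Fin n → Fin n → Set
Adj G u v = T (adj G u v)

degree : ∀ {n} → Graph n → Fin n → ℕ
degree {n} G v = length (filter (λ u → T? (adj G v u)) (allFinL n))

MinDegree : ∀ {n} → Graph n → ℕ → Set
MinDegree {n} G d = (∀ v → d ≤ degree G v) × (∃[ v ] degree G v ≡ d)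

CommonNeighbour : ∀ {n} → Graph n → Fin n → Fin n → Set
CommonNeighbour {n} G u v = ∃[ w ] (Adj G u w × Adj G v w)

IsInjectiveColoring : ∀ {n} → Graph n → (k : ℕ) → (Fin n → Fin k) → Set
IsInjectiveColoring G k f =
  ∀ u v → u ≢ v → CommonNeighbour G u v → f u ≢ f v

InjectivelyColorable : ∀ {n} → Graph n → ℕ → Set
InjectivelyColorable {n} G k = Σ (Fin n → Fin k) (IsInjectiveColoring G k)

InjectiveChromaticNumber : ∀ {n} → Graph n → ℕ → Set
InjectiveChromaticNumber G k =
  InjectivelyColorable G k × (∀ j → InjectivelyColorable G j → k ≤ j)

module Submission where

-- Both parts rest on one observation: in an injective colouring f the
-- neighbours of any vertex x receive pairwise distinct colours (they share
-- the neighbour x), so deg x ≤ k, and two distinct vertices of the same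
-- colour have disjoint neighbourhoods.
--
-- (1) If 2δ ≥ n + 1 then two distinct vertices u, v cannot have disjoint
--     neighbourhoods (deg u + deg v would exceed n), so they have a common
--     neighbour; hence every injective colouring is injective as a map and
--     needs n colours, while the identity colouring uses n.
-- (2) If δ = ⌊(n-1)/2⌋ and χ ≤ δ, take an optimal colouring f and a colour
--     c.  Every neighbourhood has size exactly χ and carries every colour,
--     so every vertex has a neighbour coloured c.  Since 2δ < n we can
--     pick c-coloured y, y', y'' one after another, each adjacent to a
--     vertex outside the previous neighbourhoods; these neighbourhoods are
--     pairwise disjoint and
--     have total size 3δ ≥ n, so they cover V and y, y', y'' are the only
--     c-coloured vertices.  Each of them has exactly one c-coloured
--     neighbour among the other two, which is impossible for three
--     vertices (a perfect matching on an odd set).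

open import Defs
open import Data.Nat using (ℕ; suc; _≤_; _+_; _*_; _∸_; _/_)
open import Data.Product using (_×_)
open import Relation.Binary.PropositionalEquality using (_≡_)

open import Data.Nat using (_<_; s≤s; z≤n; _%_; _≤?_)
open import Data.Nat.Properties
  using (≤-trans; ≤-reflexive; ≤-antisym; ≤-pred; +-mono-≤; +-monoˡ-≤; +-monoʳ-≤;
         ≮⇒≥; ≰⇒>; 1+n≰n; +-comm; +-identityʳ; *-comm; m≤m+n; m≤n+m; module ≤-Reasoning)
open import Data.Nat.DivMod using (m≡m%n+[m/n]*n; m%n<n; /-monoˡ-≤)
open import Data.Fin using (Fin; _≟_; zero; suc)
open import Data.Fin.Properties using (pigeonhole; ¬∀⟶∃¬; any?; <⇒≢)
open import Data.Bool using (T)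
open import Data.Bool.Properties using (T?)
open import Data.List using (List; []; _∷_; length; filter; map; lookup; _++_)
open import Data.List using () renaming (allFin to allFinL)
open import Data.List.Properties using (length-++; length-map)
open import Data.List.Membership.Propositional using (_∈_; _∉_)
open import Data.List.Membership.Propositional.Properties
  using (∈-filter⁺; ∈-filter⁻; ∈-allFin; ∈-lookup; ∈-map⁻; ∈-++⁺ˡ; ∈-++⁺ʳ; ∈-++⁻)
import Data.List.Membership.DecPropositional as DecMembership
open import Data.List.Relation.Unary.Any as Any using ()
open import Data.List.Relation.Unary.Any.Properties using (lookup-index)
open import Data.List.Relation.Unary.All as All using (All; []; _∷_)
open import Data.List.Relation.Unary.All.Properties using (¬Any⇒All¬)
open import Data.List.Relation.Unary.Unique.Propositional using (Unique)
open import Data.List.Relation.Unary.AllPairs using ([]; _∷_)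
import Data.List.Relation.Unary.Unique.Propositional.Properties as Unique
open import Data.List.Relation.Binary.Disjoint.Propositional using (Disjoint)
open import Data.Product using (_,_; proj₁; proj₂; ∃-syntax)
open import Data.Sum using (_⊎_; inj₁; inj₂; [_,_]′; map₂; swap)
open import Data.Empty using (⊥; ⊥-elim)
open import Relation.Nullary using (¬_; yes; no; Dec)
open import Relation.Nullary.Decidable using (_×-dec_)
open import Relation.Binary.PropositionalEquality
  using (_≢_; refl; sym; trans; cong; subst; module ≡-Reasoning)

_∈?_ : ∀ {n} (x : Fin n) (xs : List (Fin n)) → Dec (x ∈ xs)
x ∈? xs = DecMembership._∈?_ _≟_ x xs

lookup-injective : ∀ {n} (xs : List (Fin n)) → Unique xs →
                   ∀ i j → lookup xs i ≡ lookup xs j → i ≡ j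
lookup-injective (x ∷ xs) (x∉ ∷ u) zero    zero    e = refl
lookup-injective (x ∷ xs) (x∉ ∷ u) zero    (suc j) e = ⊥-elim (All.lookup x∉ (∈-lookup j) e)
lookup-injective (x ∷ xs) (x∉ ∷ u) (suc i) zero    e = ⊥-elim (All.lookup x∉ (∈-lookup i) (sym e))
lookup-injective (x ∷ xs) (x∉ ∷ u) (suc i) (suc j) e = cong suc (lookup-injective xs u i j e)

unique-length≤ : ∀ {n} (xs : List (Fin n)) → Unique xs → length xs ≤ n
unique-length≤ xs u = ≮⇒≥ λ n<len →
  let (i , j , i<j , e) = pigeonhole n<len (lookup xs)
  in <⇒≢ i<j (lookup-injective xs u i j e)

covering-length≥ : ∀ {n} (xs : List (Fin n)) → (∀ x → x ∈ xs) → n ≤ length xs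
covering-length≥ xs cover = ≮⇒≥ λ len<n →
  let (i , j , i<j , e) = pigeonhole len<n (λ x → Any.index (cover x))
  in <⇒≢ i<j (begin
       i                             ≡⟨ lookup-index (cover i) ⟩
       lookup xs (Any.index (cover i)) ≡⟨ cong (lookup xs) e ⟩
       lookup xs (Any.index (cover j)) ≡⟨ lookup-index (cover j) ⟨
       j                             ∎)
  where open ≡-Reasoning

short-list-misses : ∀ {n} (xs : List (Fin n)) → length xs < n → ∃[ x ] x ∉ xs
short-list-misses {n} xs len<n =
  ¬∀⟶∃¬ n (_∈ xs) (_∈? xs) λ cover → 1+n≰n (≤-trans len<n (covering-length≥ xs cover))

long-unique-covers : ∀ {n} (xs : List (Fin n)) → Unique xs → n ≤ length xs → ∀ x → x ∈ xs
long-unique-covers xs u n≤len x with x ∈? xs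
... | yes x∈ = x∈
... | no  x∉ = ⊥-elim (1+n≰n (≤-trans (s≤s n≤len) (unique-length≤ (x ∷ xs) (¬Any⇒All¬ xs x∉ ∷ u))))

half-bounds : ∀ n → 5 ≤ n → let δ = (n ∸ 1) / 2 in
              (2 ≤ δ) × (δ + δ < n) × (n ≤ δ + δ + 2)
half-bounds (suc m) (s≤s 4≤m) =
  /-monoˡ-≤ 2 4≤m ,
  s≤s (≤-trans (m≤n+m (δ + δ) (m % 2)) (≤-reflexive (sym m≡r+2δ))) ,
  ≤-trans (s≤s (≤-trans (≤-reflexive m≡r+2δ) (+-monoˡ-≤ (δ + δ) (≤-pred (m%n<n m 2)))))
          (≤-reflexive (+-comm 2 (δ + δ)))
  where
  δ : ℕ
  δ = m / 2
  m≡r+2δ : m ≡ m % 2 + (δ + δ)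
  m≡r+2δ = trans (m≡m%n+[m/n]*n m 2) (cong (m % 2 +_) (trans (*-comm δ 2) (cong (δ +_) (+-identityʳ δ))))

module Neighbourhoods {n : ℕ} (G : Graph n) where

  N : Fin n → List (Fin n)
  N x = filter (λ u → T? (adj G x u)) (allFinL n)

  N-unique : ∀ x → Unique (N x)
  N-unique x = Unique.filter⁺ (λ u → T? (adj G x u)) (Unique.allFin⁺ n)

  ∈N⁺ : ∀ {x u} → Adj G x u → u ∈ N x
  ∈N⁺ {x} {u} xu = ∈-filter⁺ (λ u → T? (adj G x u)) (∈-allFin u) xu

  ∈N⁻ : ∀ {x u} → u ∈ N x → Adj G x u
  ∈N⁻ {x} u∈ = proj₂ (∈-filter⁻ (λ u → T? (adj G x u)) {xs = allFinL n} u∈)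

  Adj-sym : ∀ {u v} → Adj G u v → Adj G v u
  Adj-sym {u} {v} uv = subst T (adj-sym G u v) uv

  Adj-irrefl : ∀ {u} → ¬ Adj G u u
  Adj-irrefl {u} uu = subst T (adj-irrefl G u) uu

  no-common-neighbour⇒degree-sum≤ : ∀ u v → ¬ CommonNeighbour G u v → degree G u + degree G v ≤ n
  no-common-neighbour⇒degree-sum≤ u v none =
    subst (_≤ n) (length-++ (N u))
      (unique-length≤ (N u ++ N v)
        (Unique.++⁺ (N-unique u) (N-unique v) λ (p , q) → none (_ , ∈N⁻ p , ∈N⁻ q)))

  module InjectiveColouring {k : ℕ} (f : Fin n → Fin k) (inj : IsInjectiveColoring G k f) where

    same-colour-common-neighbour : ∀ {a b w} → Adj G a w → Adj G b w → f a ≡ f b → a ≡ b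
    same-colour-common-neighbour {a} {b} {w} aw bw fa≡fb with a ≟ b
    ... | yes a≡b = a≡b
    ... | no  a≢b = ⊥-elim (inj a b a≢b (w , aw , bw) fa≡fb)

    neighbour-colours-unique : ∀ x (xs : List (Fin n)) → All (Adj G x) xs → Unique xs → Unique (map f xs)
    neighbour-colours-unique x []       []          []           = []
    neighbour-colours-unique x (a ∷ xs) (xa ∷ xxs) (a∉ ∷ u) =
      distinct-from-a xs xxs a∉ ∷ neighbour-colours-unique x xs xxs u
      where
      distinct-from-a : ∀ bs → All (Adj G x) bs → All (a ≢_) bs → All (f a ≢_) (map f bs)
      distinct-from-a []       []          []          = []
      distinct-from-a (b ∷ bs) (xb ∷ xbs) (a≢b ∷ ne) =
        (λ fa≡fb → a≢b (same-colour-common-neighbour (Adj-sym xa) (Adj-sym xb) fa≡fb))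
        ∷ distinct-from-a bs xbs ne

    N-colours-unique : ∀ x → Unique (map f (N x))
    N-colours-unique x = neighbour-colours-unique x (N x) (All.tabulate ∈N⁻) (N-unique x)

    degree≤colours : ∀ x → degree G x ≤ k
    degree≤colours x = subst (_≤ k) (length-map f (N x)) (unique-length≤ (map f (N x)) (N-colours-unique x))

    sees-every-colour : ∀ x → k ≤ degree G x → ∀ c → ∃[ u ] (Adj G x u × f u ≡ c)
    sees-every-colour x k≤deg c
      with ∈-map⁻ f (long-unique-covers (map f (N x)) (N-colours-unique x)
                      (subst (k ≤_) (sym (length-map f (N x))) k≤deg) c)
    ... | u , u∈ , c≡fu = u , ∈N⁻ u∈ , sym c≡fu

    same-colour-disjoint : ∀ a b → a ≢ b → f a ≡ f b → Disjoint (N a) (N b)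
    same-colour-disjoint a b a≢b fa≡fb (p , q) = a≢b (same-colour-common-neighbour (∈N⁻ p) (∈N⁻ q) fa≡fb)

    module DominatingClass (c : Fin k) (sees-c : ∀ x → ∃[ y ] (Adj G x y × f y ≡ c)) where

      OneOf : Fin n → Fin n → Fin n → Fin n → Set
      OneOf y y' y'' s = s ≡ y ⊎ s ≡ y' ⊎ s ≡ y''

      -- If a list L misses a vertex, some c-coloured y has a neighbour
      -- outside L, so y differs from every z whose neighbourhood lies in L.
      fresh-class-vertex : (L : List (Fin n)) → length L < n →
                           ∃[ y ] (f y ≡ c × (∀ z → (∀ {w} → w ∈ N z → w ∈ L) → y ≢ z))
      fresh-class-vertex L len<n with short-list-misses L len<n
      ... | x , x∉L with sees-c x
      ...   | y , xy , fy≡c = y , fy≡c , λ { z Nz⊆L refl → x∉L (Nz⊆L (∈N⁺ (Adj-sym xy))) }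

      covered-class : ∀ y y' y'' → f y ≡ c → f y' ≡ c → f y'' ≡ c →
                      (∀ w → w ∈ (N y ++ N y') ++ N y'') → ∀ s → f s ≡ c → OneOf y y' y'' s
      covered-class y y' y'' fy fy' fy'' cover s fs with sees-c s
      ... | w , sw , _ = [ (λ w∈ → [ (λ q → inj₁ (same-as y fy q))
                                   , (λ q → inj₂ (inj₁ (same-as y' fy' q))) ]′ (∈-++⁻ (N y) w∈))
                         , (λ q → inj₂ (inj₂ (same-as y'' fy'' q))) ]′ (∈-++⁻ (N y ++ N y') (cover w))
        where
        same-as : ∀ t → f t ≡ c → w ∈ N t → s ≡ t
        same-as t ft w∈ = same-colour-common-neighbour sw (∈N⁻ w∈) (trans fs (sym ft))

      -- Adjacent c-coloured y, y' and a third c-coloured y'' cannot exhaust the class: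
      -- the c-coloured neighbour of y'' would be a second one for y or y'.
      no-matched-pair-and-third : ∀ y y' y'' → Adj G y y' → f y ≡ c → f y' ≡ c → f y'' ≡ c →
                                  y ≢ y'' → y' ≢ y'' → (∀ s → f s ≡ c → OneOf y y' y'' s) → ⊥
      no-matched-pair-and-third y y' y'' yy' fy fy' fy'' y≢y'' y'≢y'' class with sees-c y''
      ... | t , y''t , ft with class t ft
      ...   | inj₁ refl        = y'≢y'' (same-colour-common-neighbour (Adj-sym yy') y''t (trans fy' (sym fy'')))
      ...   | inj₂ (inj₁ refl) = y≢y'' (same-colour-common-neighbour yy' y''t (trans fy (sym fy'')))
      ...   | inj₂ (inj₂ refl) = Adj-irrefl y''t

      class-not-three : ∀ y y' y'' → f y ≡ c → f y' ≡ c → f y'' ≡ c →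
                        y ≢ y' → y ≢ y'' → y' ≢ y'' → (∀ s → f s ≡ c → OneOf y y' y'' s) → ⊥
      class-not-three y y' y'' fy fy' fy'' y≢y' y≢y'' y'≢y'' class with sees-c y
      ... | t , yt , ft with class t ft
      ...   | inj₁ refl        = Adj-irrefl yt
      ...   | inj₂ (inj₁ refl) = no-matched-pair-and-third y y' y'' yt fy fy' fy'' y≢y'' y'≢y'' class
      ...   | inj₂ (inj₂ refl) = no-matched-pair-and-third y y'' y' yt fy fy'' fy' y≢y' (λ e → y'≢y'' (sym e))
                                   λ s fs → map₂ swap (class s fs)

      -- Neighbourhoods of distinct c-coloured vertices are pairwise disjoint,
      -- so concatenating three of them gives a duplicate-free list.
      three-neighbourhoods-unique : ∀ y y' y'' → f y ≡ c → f y' ≡ c → f y'' ≡ c →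
                                    y ≢ y' → y ≢ y'' → y' ≢ y'' → Unique ((N y ++ N y') ++ N y'')
      three-neighbourhoods-unique y y' y'' fy fy' fy'' y≢y' y≢y'' y'≢y'' =
        Unique.++⁺ (Unique.++⁺ (N-unique y) (N-unique y') (disjoint y y' y≢y' fy fy'))
                   (N-unique y'')
                   λ (p , q) → [ (λ p₁ → disjoint y y'' y≢y'' fy fy'' (p₁ , q))
                               , (λ p₂ → disjoint y' y'' y'≢y'' fy' fy'' (p₂ , q)) ]′ (∈-++⁻ (N y) p)
        where
        disjoint : ∀ a b → a ≢ b → f a ≡ c → f b ≡ c → Disjoint (N a) (N b)
        disjoint a b a≢b fa fb = same-colour-disjoint a b a≢b (trans fa (sym fb))

      -- Pick c-coloured y, y', y''
      -- each outside the neighbourhoods of the previous ones; their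
      -- neighbourhoods then cover V, so the class has exactly three members.
      no-dominating-class : ∀ d D → (∀ x → d ≤ degree G x) → (∀ x → degree G x ≤ D) →
                            D + D < n → n ≤ d + d + d → ⊥
      no-dominating-class d D d≤deg deg≤D 2D<n n≤3d
        with fresh-class-vertex [] (≤-trans (s≤s z≤n) 2D<n)
      ... | y , fy , _
        with fresh-class-vertex (N y) (≤-trans (s≤s (deg≤D y)) (≤-trans (s≤s (m≤m+n D D)) 2D<n))
      ... | y' , fy' , y'-new
        with fresh-class-vertex (N y ++ N y')
               (subst (_< n) (sym (length-++ (N y))) (≤-trans (s≤s (+-mono-≤ (deg≤D y) (deg≤D y'))) 2D<n))
      ... | y'' , fy'' , y''-new =
        class-not-three y y' y'' fy fy' fy'' y≢y' y≢y'' y'≢y''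
          (covered-class y y' y'' fy fy' fy''
            (long-unique-covers L (three-neighbourhoods-unique y y' y'' fy fy' fy'' y≢y' y≢y'' y'≢y'') n≤|L|))
        where
        y≢y' : y ≢ y'
        y≢y' e = y'-new y (λ w∈ → w∈) (sym e)
        y≢y'' : y ≢ y''
        y≢y'' e = y''-new y ∈-++⁺ˡ (sym e)
        y'≢y'' : y' ≢ y''
        y'≢y'' e = y''-new y' (∈-++⁺ʳ (N y)) (sym e)
        L : List (Fin n)
        L = (N y ++ N y') ++ N y''
        n≤|L| : n ≤ length L
        n≤|L| = ≤-trans n≤3d (subst (d + d + d ≤_)
                  (sym (trans (length-++ (N y ++ N y')) (cong (_+ degree G y'') (length-++ (N y)))))
                  (+-mono-≤ (+-mono-≤ (d≤deg y) (d≤deg y')) (d≤deg y'')))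

  -- Part (1).  If 2δ ≥ n + 1 then any two vertices have a common neighbour:
  -- otherwise their degrees, each at least δ, would sum to at most n.
  dense⇒common-neighbour : ∀ δ → (∀ v → δ ≤ degree G v) → n + 1 ≤ 2 * δ → ∀ u v → CommonNeighbour G u v
  dense⇒common-neighbour δ δ≤deg n+1≤2δ u v with any? (λ w → T? (adj G u w) ×-dec T? (adj G v w))
  ... | yes common = common
  ... | no  none   = ⊥-elim (1+n≰n (begin
        suc n                     ≡⟨ +-comm 1 n ⟩
        n + 1                     ≤⟨ n+1≤2δ ⟩
        2 * δ                     ≡⟨ cong (δ +_) (+-identityʳ δ) ⟩
        δ + δ                     ≤⟨ +-mono-≤ (δ≤deg u) (δ≤deg v) ⟩
        degree G u + degree G v   ≤⟨ no-common-neighbour⇒degree-sum≤ u v none ⟩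
        n                         ∎))
    where open ≤-Reasoning

  -- When every pair of vertices has a common neighbour, an injective
  -- colouring is an injective map, so it uses at least n colours.
  all-common⇒order≤colours : (∀ u v → CommonNeighbour G u v) → ∀ k → InjectivelyColorable G k → n ≤ k
  all-common⇒order≤colours common k (f , inj) = ≮⇒≥ λ k<n →
    let (i , j , i<j , fi≡fj) = pigeonhole k<n f
    in inj i j (<⇒≢ i<j) (common i j) fi≡fj

  identity-colouring : InjectivelyColorable G n
  identity-colouring = (λ x → x) , λ u v u≢v _ → u≢v

  dense⇒χ≡n : ∀ δ χ → MinDegree G δ → InjectiveChromaticNumber G χ → n + 1 ≤ 2 * δ → χ ≡ n
  dense⇒χ≡n δ χ (δ≤deg , _) (colourable , minimal) n+1≤2δ =
    ≤-antisym (minimal n identity-colouring)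
              (all-common⇒order≤colours (dense⇒common-neighbour δ δ≤deg n+1≤2δ) χ colourable)

  -- If δ = ⌊(n-1)/2⌋ and an optimal colouring used χ ≤ δ colours,
  -- every degree would equal χ = δ and any colour class would be dominating,
  -- contradicting no-dominating-class since 2δ < n ≤ 2δ + 2 ≤ 3δ.
  half-degree⇒δ<χ : ∀ δ χ → 5 ≤ n → MinDegree G δ → InjectiveChromaticNumber G χ → δ ≡ (n ∸ 1) / 2 → δ + 1 ≤ χ
  half-degree⇒δ<χ δ χ 5≤n (δ≤deg , z , _) ((f , inj) , _) refl with δ + 1 ≤? χ
  ... | yes δ<χ = δ<χ
  ... | no  δ≮χ =
    ⊥-elim (DominatingClass.no-dominating-class (f z) (λ x → sees-every-colour x (χ≤deg x) (f z))
              δ δ δ≤deg (λ x → ≤-trans (degree≤colours x) χ≤δ) 2δ<n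
              (≤-trans n≤2δ+2 (+-monoʳ-≤ (δ + δ) 2≤δ)))
    where
    open InjectiveColouring f inj
    χ≤δ : χ ≤ δ
    χ≤δ = ≤-pred (subst (suc χ ≤_) (+-comm δ 1) (≰⇒> δ≮χ))
    χ≤deg : ∀ x → χ ≤ degree G x
    χ≤deg x = ≤-trans χ≤δ (δ≤deg x)
    2≤δ : 2 ≤ δ
    2≤δ = proj₁ (half-bounds n 5≤n)
    2δ<n : δ + δ < n
    2δ<n = proj₁ (proj₂ (half-bounds n 5≤n))
    n≤2δ+2 : n ≤ δ + δ + 2
    n≤2δ+2 = proj₂ (proj₂ (half-bounds n 5≤n))

lemma4 : ∀ {n : ℕ} (G : Graph n) (δ χ : ℕ) → 5 ≤ n → MinDegree G δ → InjectiveChromaticNumber G χ →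
             ((n + 1 ≤ 2 * δ → χ ≡ n) × (δ ≡ (n ∸ 1) / 2 → δ + 1 ≤ χ))
lemma4 G δ χ 5≤n minDegree χ-optimal =
  dense⇒χ≡n δ χ minDegree χ-optimal , half-degree⇒δ<χ δ χ 5≤n minDegree χ-optimal
  where open Neighbourhoods G
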